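{- Let $Q$ be a complete quiver with at least one frozen vertex, and let $\mathbf M=m_1m_2\cdots$ be a reduced, weakly balanced, cycle-preserving mutation sequence on $Q$ such that $m_1$ is not the apex of a vortex subquiver of $Q$. Then $Q$ is eventually sign-coherent on $\mathbf M$: there exists $T$ such that $Q^{(j)}_{\mathbf M}$ is sign-coherent for all $j>T$.
   Context: Quiver: finite directed graph without loops or oriented 2-cycles, vertices partitioned into mutable and frozen, arrows between frozen vertices ignored; $b_{ij}$ = #arrows $i\to j$ − #arrows $j\to i$. Mutation $\mu_j$: for each path $i\xrightarrow{a}j\xrightarrow{b}k$ add $ab$ arrows $i\to k$, reverse arrows at $j$, cancel 2-cycles; $Q^{(0)}_{\mathbf M}=Q$, $Q^{(i)}_{\mathbf M}=\mu_{m_i}(Q^{(i-1)}_{\mathbf M})$. Complete: at least one arrow between every pair of vertices at least one of which is mutable. Reduced: $m_i\ne m_{i+1}$; weakly balanced: every mutable vertex appears infinitely often. A 3-vertex quiver is an oriented cycle if it has at most one frozen vertex and is not acyclic. $j$ is cycle-preserving for $P$ if whenever $P|_{ijk}$ is an oriented 3-cycle containing $j$, so is $\mu_j(P)|_{ijk}$; $\mathbf M$ is cycle-preserving if $m_\ell$ is cycle-preserving for $Q^{(\ell-1)}_{\mathbf M}$ for all $\ell\ge1$. A vortex is a 4-vertex quiver, at least three vertices mutable, with one vertex (apex) a source or sink and the other three supporting an oriented cycle. A mutable vertex adjacent to some frozen vertex is red (green) if all arrows between it and frozen vertices point toward (away from) it; a quiver is sign-coherent if all mutable vertices are red or green. 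-}

module Defs where

open import Data.Nat using (ℕ; zero; suc) renaming (_+_ to _+ℕ_; _≤_ to _≤ℕ_)
open import Data.Fin using (Fin; _≟_)
open import Data.Bool using (Bool; true; false; if_then_else_; _∨_)
open import Data.Integer using (ℤ; _+_; _-_; -_; _*_; _≤_; _<_; 0ℤ; _⊔_)
open import Data.Product using (Σ; ∃; _×_; _,_)
open import Data.Sum using (_⊎_)
open import Relation.Nullary using (¬_; does)
open import Relation.Binary.PropositionalEquality using (_≡_; _≢_)

-- A quiver on the vertex set Fin n is encoded (as usual) by its exchange
-- matrix b_ij = #(i→j) − #(j→i), which is skew-symmetric, together with the
-- marking  frozen : Fin n → Bool  (true = frozen, false = mutable).
Mat : ℕ → Set
Mat n = Fin n → Fin n → ℤ

SkewSymmetric : {n : ℕ} → Mat n → Set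
SkewSymmetric B = ∀ i j → B i j ≡ - B j i

Frozen : {n : ℕ} → (Fin n → Bool) → Fin n → Set
Frozen fr i = fr i ≡ true

Mutable : {n : ℕ} → (Fin n → Bool) → Fin n → Set
Mutable fr i = fr i ≡ false

[_]₊ : ℤ → ℤ
[ x ]₊ = x ⊔ 0ℤ

-- Quiver mutation μ_j : for each path i →a j →b k add ab arrows i → k,
-- reverse arrows at j, cancel 2-cycles.
μ : {n : ℕ} → Fin n → Mat n → Mat n
μ j B i k =
  if does (i ≟ j) ∨ does (k ≟ j)
  then - B i k
  else B i k + [ B i j ]₊ * [ B j k ]₊ - [ - B i j ]₊ * [ - B j k ]₊

-- Mutation sequence M = m_1 m_2 ⋯ is encoded as m : ℕ → Fin n with
-- m ℓ = m_{ℓ+1}.  mutSeq B m ℓ = Q^{(ℓ)}_M.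
mutSeq : {n : ℕ} → Mat n → (ℕ → Fin n) → ℕ → Mat n
mutSeq B m zero = B
mutSeq B m (suc ℓ) = μ (m ℓ) (mutSeq B m ℓ)

Complete : {n : ℕ} → (Fin n → Bool) → Mat n → Set
Complete fr B = ∀ i j → i ≢ j → (Mutable fr i ⊎ Mutable fr j) → B i j ≢ 0ℤ

AllMutable : {n : ℕ} → (Fin n → Bool) → (ℕ → Fin n) → Set
AllMutable fr m = ∀ ℓ → Mutable fr (m ℓ)

Reduced : {n : ℕ} → (ℕ → Fin n) → Set
Reduced m = ∀ ℓ → m ℓ ≢ m (suc ℓ)

WeaklyBalanced : {n : ℕ} → (Fin n → Bool) → (ℕ → Fin n) → Set
WeaklyBalanced fr m = ∀ v → Mutable fr v → ∀ N → ∃ λ ℓ → N ≤ℕ ℓ × m ℓ ≡ v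

mutCount : {n : ℕ} → (Fin n → Bool) → Fin n → Fin n → Fin n → ℕ
mutCount fr i j k = c i +ℕ c j +ℕ c k
  where c : _ → ℕ
        c x = if fr x then 0 else 1

-- The full subquiver on the three distinct vertices i, j, k is an oriented
-- cycle: at most one of them is frozen, and it is not acyclic.  (On three
-- vertices without loops/2-cycles, "not acyclic" means the arrows form a
-- directed 3-cycle, in one of the two orientations.)
OrientedCycle : {n : ℕ} → (Fin n → Bool) → Mat n → Fin n → Fin n → Fin n → Set
OrientedCycle fr B i j k =
  i ≢ j × j ≢ k × i ≢ k ×
  2 ≤ℕ mutCount fr i j k ×
  ((0ℤ < B i j × 0ℤ < B j k × 0ℤ < B k i) ⊎ (0ℤ < B j i × 0ℤ < B k j × 0ℤ < B i k))

CyclePreservingAt : {n : ℕ} → (Fin n → Bool) → Mat n → Fin n → Set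
CyclePreservingAt fr P j =
  ∀ i k → OrientedCycle fr P i j k → OrientedCycle fr (μ j P) i j k

CyclePreserving : {n : ℕ} → (Fin n → Bool) → Mat n → (ℕ → Fin n) → Set
CyclePreserving fr B m = ∀ ℓ → CyclePreservingAt fr (mutSeq B m ℓ) (m ℓ)

VortexApex : {n : ℕ} → (Fin n → Bool) → Mat n → Fin n → Set
VortexApex fr B a = Σ _ λ x → Σ _ λ y → Σ _ λ z →
  a ≢ x × a ≢ y × a ≢ z ×
  3 ≤ℕ (c a +ℕ mutCount fr x y z) ×
  ((0ℤ ≤ B a x × 0ℤ ≤ B a y × 0ℤ ≤ B a z) ⊎ (B a x ≤ 0ℤ × B a y ≤ 0ℤ × B a z ≤ 0ℤ)) ×
  OrientedCycle fr B x y z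
  where c : _ → ℕ
        c v = if fr v then 0 else 1

Red : {n : ℕ} → (Fin n → Bool) → Mat n → Fin n → Set
Red fr B v = ∀ f → Frozen fr f → B v f ≤ 0ℤ

Green : {n : ℕ} → (Fin n → Bool) → Mat n → Fin n → Set
Green fr B v = ∀ f → Frozen fr f → 0ℤ ≤ B v f

SignCoherent : {n : ℕ} → (Fin n → Bool) → Mat n → Set
SignCoherent fr B = ∀ v → Mutable fr v → Red fr B v ⊎ Green fr B v

{-# OPTIONS --safe #-}
module Submission where

-- Mutating a complete quiver at a cycle-preserving mutable vertex j that is not a vortex apex
-- produces a fork with point j: no oriented 3-cycle avoids j, and every path x → j → y is
-- closed by an arrow y → x.  A fork has no vortex with mutable apex, so inductively every
-- Q⁽ℓ⁺¹⁾ is a fork with point m_ℓ.  Mutating a fork with point r at k ≠ r makes r a source or a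
-- sink apart from k, hence green or red, keeps every arrow between vertices outside {k, r}, and
-- swaps red and green at k; so a mutable vertex that is red or green stays so.  Hence a vertex
-- mutated at step ℓ is red or green at every step after ℓ + 1, and weak balance bounds these
-- steps uniformly over the finitely many vertices.

open import Defs
open import Data.Nat using (ℕ; _<_)
open import Data.Fin using (Fin)
open import Data.Bool using (Bool)
open import Data.Product using (∃; _×_)
open import Relation.Nullary using (¬_)

open import Data.Nat as ℕ using (zero; suc; s≤s; z≤n; _≤′_; ≤′-refl; ≤′-reflexive; ≤′-step)
import Data.Nat.Properties as ℕP
open import Data.Fin as Fin using (_≟_)
open import Data.Bool using (true; false; if_then_else_)
open import Data.Integer as ℤ using (_+_; _-_; -_; _*_; 0ℤ; _≤_; +≤+)
import Data.Integer.Properties as ℤP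
open import Data.Integer.Tactic.RingSolver using (solve-∀)
open import Data.Product using (_,_)
open import Data.Sum using (_⊎_; inj₁; inj₂; swap; map)
open import Data.Empty using (⊥; ⊥-elim)
open import Function using (_∘_)
open import Relation.Nullary using (Dec; yes; no)
open import Relation.Binary using (tri<; tri≈; tri>)
open import Relation.Binary.PropositionalEquality
  using (_≡_; _≢_; refl; sym; trans; cong; subst; ≢-sym)

0≤[i]₊ : ∀ i → 0ℤ ≤ [ i ]₊
0≤[i]₊ i = ℤP.i≤j⊔i _ _

i≤0⇒[i]₊≡0 : ∀ {i} → i ≤ 0ℤ → [ i ]₊ ≡ 0ℤ
i≤0⇒[i]₊≡0 = ℤP.i≤j⇒i⊔j≡j

0≤i⇒0≤j⇒0≤i*j : ∀ {i j} → 0ℤ ≤ i → 0ℤ ≤ j → 0ℤ ≤ i * j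
0≤i⇒0≤j⇒0≤i*j (+≤+ {n = a} _) (+≤+ {n = b} _) = subst (0ℤ ≤_) (ℤP.pos-* a b) (+≤+ z≤n)

Arrow : {n : ℕ} → Mat n → Fin n → Fin n → Set
Arrow P x y = 0ℤ ℤ.< P x y

module _ {n : ℕ} {P : Mat n} (skew : SkewSymmetric P) where

  arrow⇒reverse<0 : ∀ {x y} → Arrow P x y → P y x ℤ.< 0ℤ
  arrow⇒reverse<0 {x} {y} x→y = subst (ℤ._< 0ℤ) (sym (skew y x)) (ℤP.neg-mono-< x→y)

  <0⇒reverse-arrow : ∀ {x y} → P x y ℤ.< 0ℤ → Arrow P y x
  <0⇒reverse-arrow {x} {y} xy<0 = subst (0ℤ ℤ.<_) (sym (skew y x)) (ℤP.neg-mono-< xy<0)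

  arrow-asym : ∀ {x y} → Arrow P x y → ¬ Arrow P y x
  arrow-asym x→y = ℤP.<-asym (arrow⇒reverse<0 x→y)

  arrow⇒≢ : ∀ {x y} → Arrow P x y → x ≢ y
  arrow⇒≢ x→x refl = arrow-asym x→x x→x

  arrow⊎arrow⇒≢0 : ∀ {x y} → Arrow P x y ⊎ Arrow P y x → P x y ≢ 0ℤ
  arrow⊎arrow⇒≢0 (inj₁ x→y) xy≡0 = ℤP.<-irrefl (sym xy≡0) x→y
  arrow⊎arrow⇒≢0 (inj₂ y→x) xy≡0 = ℤP.<-irrefl xy≡0 (arrow⇒reverse<0 y→x)

μ-row : ∀ {n} j (P : Mat n) k → μ j P j k ≡ - P j k
μ-row j P k with j ≟ j
... | yes _ = refl
... | no j≢j = ⊥-elim (j≢j refl)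

μ-column : ∀ {n} j (P : Mat n) i → μ j P i j ≡ - P i j
μ-column j P i with i ≟ j | j ≟ j
... | yes _ | _ = refl
... | no _ | yes _ = refl
... | no _ | no j≢j = ⊥-elim (j≢j refl)

μ-away : ∀ {n} j (P : Mat n) {i k} → i ≢ j → k ≢ j →
  μ j P i k ≡ P i k + [ P i j ]₊ * [ P j k ]₊ - [ - P i j ]₊ * [ - P j k ]₊
μ-away j P {i} {k} i≢j k≢j with i ≟ j | k ≟ j
... | yes i≡j | _ = ⊥-elim (i≢j i≡j)
... | no _ | yes k≡j = ⊥-elim (k≢j k≡j)
... | no _ | no _ = refl

μ-skewSymmetric : ∀ {n j} {P : Mat n} → SkewSymmetric P → SkewSymmetric (μ j P)
μ-skewSymmetric {j = j} {P} skew i k with i ≟ j | k ≟ j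
... | yes _ | yes _ = cong -_ (skew i k)
... | yes _ | no _ = cong -_ (skew i k)
... | no _ | yes _ = cong -_ (skew i k)
... | no _ | no _
  rewrite skew k i | skew k j | skew j i | ℤP.neg-involutive (P i j) | ℤP.neg-involutive (P j k)
  = swap-paths (P i k) [ P i j ]₊ [ P j k ]₊ [ - P i j ]₊ [ - P j k ]₊
  where
  swap-paths : ∀ a b c d e → a + b * c - d * e ≡ - (- a + e * d - c * b)
  swap-paths = solve-∀

-- The subtracted term of μ counts the paths k → j → i.
μ-keeps-arrow : ∀ {n} (P : Mat n) {i j k} → i ≢ j → k ≢ j →
  Arrow P i j ⊎ Arrow P j k → Arrow P i k → Arrow (μ j P) i k
μ-keeps-arrow P {i} {j} {k} i≢j k≢j no-path i→k =
  subst (0ℤ ℤ.<_) (sym (μ-away j P i≢j k≢j)) positive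
  where
  no-reverse-path : Arrow P i j ⊎ Arrow P j k → [ - P i j ]₊ * [ - P j k ]₊ ≡ 0ℤ
  no-reverse-path (inj₁ i→j) =
    cong (_* [ - P j k ]₊) (i≤0⇒[i]₊≡0 (ℤP.neg-mono-≤ (ℤP.<⇒≤ i→j)))
  no-reverse-path (inj₂ j→k) =
    trans (cong ([ - P i j ]₊ *_) (i≤0⇒[i]₊≡0 (ℤP.neg-mono-≤ (ℤP.<⇒≤ j→k)))) (ℤP.*-zeroʳ [ - P i j ]₊)
  positive : 0ℤ ℤ.< P i k + [ P i j ]₊ * [ P j k ]₊ - [ - P i j ]₊ * [ - P j k ]₊
  positive rewrite no-reverse-path no-path | ℤP.+-identityʳ (P i k + [ P i j ]₊ * [ P j k ]₊) =
    ℤP.+-mono-<-≤ i→k (0≤i⇒0≤j⇒0≤i*j (0≤[i]₊ (P i j)) (0≤[i]₊ (P j k)))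

μ-reverses-out : ∀ {n j} {P : Mat n} → SkewSymmetric P → ∀ {y} → Arrow (μ j P) j y → Arrow P y j
μ-reverses-out {j = j} {P} skew {y} j→y =
  <0⇒reverse-arrow skew (ℤP.neg-cancel-< (subst (0ℤ ℤ.<_) (μ-row j P y) j→y))

μ-reverses-in : ∀ {n j} {P : Mat n} → SkewSymmetric P → ∀ {x} → Arrow (μ j P) x j → Arrow P j x
μ-reverses-in {j = j} {P} skew {x} x→j =
  <0⇒reverse-arrow skew (ℤP.neg-cancel-< (subst (0ℤ ℤ.<_) (μ-column j P x) x→j))

SourceOrSink : {n : ℕ} → Mat n → Fin n → Fin n → Fin n → Fin n → Set
SourceOrSink P k a b c =
  (0ℤ ≤ P k a × 0ℤ ≤ P k b × 0ℤ ≤ P k c) ⊎ (P k a ≤ 0ℤ × P k b ≤ 0ℤ × P k c ≤ 0ℤ)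

private
  weight : Bool → ℕ
  weight b = if b then 0 else 1

  pairwise-false⇒2≤weight : ∀ a b c → a ≡ false ⊎ b ≡ false → b ≡ false ⊎ c ≡ false →
    c ≡ false ⊎ a ≡ false → 2 ℕ.≤ weight a ℕ.+ weight b ℕ.+ weight c
  pairwise-false⇒2≤weight false false _ _ _ _ = s≤s (s≤s z≤n)
  pairwise-false⇒2≤weight false true false _ _ _ = s≤s (s≤s z≤n)
  pairwise-false⇒2≤weight true false false _ _ _ = s≤s (s≤s z≤n)
  pairwise-false⇒2≤weight true true _ (inj₁ ()) _ _
  pairwise-false⇒2≤weight true true _ (inj₂ ()) _ _
  pairwise-false⇒2≤weight false true true _ (inj₁ ()) _
  pairwise-false⇒2≤weight false true true _ (inj₂ ()) _
  pairwise-false⇒2≤weight true false true _ _ (inj₁ ())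
  pairwise-false⇒2≤weight true false true _ _ (inj₂ ())

  2≤weight⇒pairwise-false : ∀ a b c → 2 ℕ.≤ weight a ℕ.+ weight b ℕ.+ weight c →
    (a ≡ false ⊎ b ≡ false) × (b ≡ false ⊎ c ≡ false) × (c ≡ false ⊎ a ≡ false)
  2≤weight⇒pairwise-false false false _ _ = inj₁ refl , inj₁ refl , inj₂ refl
  2≤weight⇒pairwise-false false true false _ = inj₁ refl , inj₂ refl , inj₁ refl
  2≤weight⇒pairwise-false true false false _ = inj₂ refl , inj₁ refl , inj₁ refl
  2≤weight⇒pairwise-false true true false (s≤s ())
  2≤weight⇒pairwise-false true true true ()
  2≤weight⇒pairwise-false false true true (s≤s ())
  2≤weight⇒pairwise-false true false true (s≤s ())

module _ {n : ℕ} (fr : Fin n → Bool) where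

  EitherMutable : Fin n → Fin n → Set
  EitherMutable x y = Mutable fr x ⊎ Mutable fr y

  frozen≢mutable : ∀ {f v} → Frozen fr f → Mutable fr v → f ≢ v
  frozen≢mutable f-frozen v-mutable refl with trans (sym f-frozen) v-mutable
  ... | ()

  pairwise-mutable⇒2≤mutCount : ∀ {a b c} → EitherMutable a b → EitherMutable b c →
    EitherMutable c a → 2 ℕ.≤ mutCount fr a b c
  pairwise-mutable⇒2≤mutCount {a} {b} {c} = pairwise-false⇒2≤weight (fr a) (fr b) (fr c)

  2≤mutCount⇒pairwise-mutable : ∀ {a b c} → 2 ℕ.≤ mutCount fr a b c →
    EitherMutable a b × EitherMutable b c × EitherMutable c a
  2≤mutCount⇒pairwise-mutable {a} {b} {c} = 2≤weight⇒pairwise-false (fr a) (fr b) (fr c)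

  record Triangle (P : Mat n) (a b c : Fin n) : Set where
    constructor triangle
    field
      a→b : Arrow P a b
      b→c : Arrow P b c
      c→a : Arrow P c a
      ab-mutable : EitherMutable a b
      bc-mutable : EitherMutable b c
      ca-mutable : EitherMutable c a

  orientedCycle⇒triangle : ∀ {P x y z} → OrientedCycle fr P x y z →
    Triangle P x y z ⊎ Triangle P x z y
  orientedCycle⇒triangle (_ , _ , _ , two-mutable , orientation)
    with 2≤mutCount⇒pairwise-mutable two-mutable | orientation
  ... | xy , yz , zx | inj₁ (x→y , y→z , z→x) = inj₁ (triangle x→y y→z z→x xy yz zx)
  ... | xy , yz , zx | inj₂ (y→x , z→y , x→z) =
    inj₂ (triangle x→z z→y y→x (swap zx) (swap yz) (swap xy))

  -- Warkentin's forks, keeping only the orientation conditions.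
  record Fork (P : Mat n) (r : Fin n) : Set where
    field
      no-triangle-avoiding : ∀ {a b c} → Triangle P a b c → r ≢ a → r ≢ b → r ≢ c → ⊥
      closes-paths-through : ∀ {x y} → EitherMutable x y → Arrow P x r → Arrow P r y → Arrow P y x

  Coherent : Mat n → Fin n → Set
  Coherent P v = Red fr P v ⊎ Green fr P v

  μ-swaps-colour : ∀ (P : Mat n) {j v} → v ≡ j → Coherent P v → Coherent (μ j P) v
  μ-swaps-colour P {j} refl (inj₁ red) =
    inj₂ λ f f-frozen → subst (0ℤ ≤_) (sym (μ-row j P f)) (ℤP.neg-mono-≤ (red f f-frozen))
  μ-swaps-colour P {j} refl (inj₂ green) =
    inj₁ λ f f-frozen → subst (_≤ 0ℤ) (sym (μ-row j P f)) (ℤP.neg-mono-≤ (green f f-frozen))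

  module _ {P : Mat n} (skew : SkewSymmetric P) where

    triangle⇒orientedCycle : ∀ {a b c} → Triangle P a b c → OrientedCycle fr P a b c
    triangle⇒orientedCycle (triangle a→b b→c c→a ab bc ca) =
      arrow⇒≢ skew a→b , arrow⇒≢ skew b→c , ≢-sym (arrow⇒≢ skew c→a) ,
      pairwise-mutable⇒2≤mutCount ab bc ca , inj₁ (a→b , b→c , c→a)

    joined : Complete fr P → ∀ {x y} → x ≢ y → EitherMutable x y → Arrow P x y ⊎ Arrow P y x
    joined complete {x} {y} x≢y xy with ℤP.<-cmp 0ℤ (P x y)
    ... | tri< 0<xy _ _ = inj₁ 0<xy
    ... | tri≈ _ 0≡xy _ = ⊥-elim (complete x y x≢y xy (sym 0≡xy))
    ... | tri> _ _ xy<0 = inj₂ (<0⇒reverse-arrow skew xy<0)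

    μ-reflects-arrow : Complete fr P → ∀ {j u v} → u ≢ j → v ≢ j → EitherMutable u v →
      Arrow P v j ⊎ Arrow P j u → Arrow (μ j P) u v → Arrow P u v
    μ-reflects-arrow complete u≢j v≢j uv reverse-kept u→v
      with joined complete (arrow⇒≢ (μ-skewSymmetric skew) u→v) uv
    ... | inj₁ u→v′ = u→v′
    ... | inj₂ v→u =
      ⊥-elim (arrow-asym (μ-skewSymmetric skew) u→v (μ-keeps-arrow P v≢j u≢j reverse-kept v→u))

    opposite-arrow-flips : ∀ {j} → Mutable fr j → CyclePreservingAt fr P j →
      ∀ {a c} → EitherMutable a c → Arrow P a j → Arrow P j c → Arrow P c a → Arrow (μ j P) a c
    opposite-arrow-flips j-mutable cp ac a→j j→c c→a
      with cp _ _ (triangle⇒orientedCycle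
                     (triangle a→j j→c c→a (inj₂ j-mutable) (inj₁ j-mutable) (swap ac)))
    ... | _ , _ , _ , _ , inj₁ (a→j′ , _ , _) =
      ⊥-elim (arrow-asym skew a→j (μ-reverses-in skew a→j′))
    ... | _ , _ , _ , _ , inj₂ (_ , _ , a→c) = a→c

    module _ (complete : Complete fr P) {j : Fin n} (j-mutable : Mutable fr j)
             (cp : CyclePreservingAt fr P j) where

      μ-keeps-or-flips : ∀ {i k} → i ≢ j → k ≢ j → EitherMutable i k → Arrow P i k →
        Arrow (μ j P) i k ⊎ Arrow (μ j P) k i
      μ-keeps-or-flips i≢j k≢j ik i→k
        with joined complete i≢j (inj₂ j-mutable) | joined complete (≢-sym k≢j) (inj₁ j-mutable)
      ... | inj₁ i→j | _ = inj₁ (μ-keeps-arrow P i≢j k≢j (inj₁ i→j) i→k)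
      ... | inj₂ _ | inj₁ j→k = inj₁ (μ-keeps-arrow P i≢j k≢j (inj₂ j→k) i→k)
      ... | inj₂ j→i | inj₂ k→j = inj₂ (opposite-arrow-flips j-mutable cp (swap ik) k→j j→i i→k)

      μ-complete : Complete fr (μ j P)
      μ-complete i k i≢k ik = nonzero (i ≟ j) (k ≟ j)
        where
        nonzero : Dec (i ≡ j) → Dec (k ≡ j) → μ j P i k ≢ 0ℤ
        nonzero (yes refl) _ = complete j k i≢k ik ∘ ℤP.neg-injective ∘ trans (sym (μ-row j P k))
        nonzero (no _) (yes refl) =
          complete i j i≢k ik ∘ ℤP.neg-injective ∘ trans (sym (μ-column j P i))
        nonzero (no i≢j) (no k≢j) with joined complete i≢k ik
        ... | inj₁ i→k = arrow⊎arrow⇒≢0 (μ-skewSymmetric skew) (μ-keeps-or-flips i≢j k≢j ik i→k)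
        ... | inj₂ k→i =
          arrow⊎arrow⇒≢0 (μ-skewSymmetric skew) (swap (μ-keeps-or-flips k≢j i≢j (swap ik) k→i))

      μ-closes-paths-through : ∀ {x y} → EitherMutable x y →
        Arrow (μ j P) x j → Arrow (μ j P) j y → Arrow (μ j P) y x
      μ-closes-paths-through {x} {y} xy x→j j→y = close (joined complete x≢y xy)
        where
        j→x : Arrow P j x
        j→x = μ-reverses-in skew x→j
        y→j : Arrow P y j
        y→j = μ-reverses-out skew j→y
        x≢y : x ≢ y
        x≢y refl = arrow-asym skew j→x y→j
        close : Arrow P x y ⊎ Arrow P y x → Arrow (μ j P) y x
        close (inj₁ x→y) = opposite-arrow-flips j-mutable cp (swap xy) y→j j→x x→y
        close (inj₂ y→x) =
          μ-keeps-arrow P (arrow⇒≢ skew y→j) (≢-sym (arrow⇒≢ skew j→x)) (inj₁ y→j) y→x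

      no-arrow-across : ∀ {u v} → u ≢ j → v ≢ j → EitherMutable u v →
        Arrow P j u → Arrow P v j → ¬ Arrow (μ j P) u v
      no-arrow-across u≢j v≢j uv j→u v→j u→v =
        arrow-asym (μ-skewSymmetric skew) u→v
          (opposite-arrow-flips j-mutable cp (swap uv) v→j j→u
            (μ-reflects-arrow complete u≢j v≢j uv (inj₁ v→j) u→v))

      -- Going round the triangle, either some arrow leaves the out-neighbourhood of j for its
      -- in-neighbourhood, or all three vertices lie on one side and j is the apex of a vortex.
      μ-no-triangle-avoiding : ¬ VortexApex fr P j →
        ∀ {a b c} → Triangle (μ j P) a b c → j ≢ a → j ≢ b → j ≢ c → ⊥
      μ-no-triangle-avoiding not-apex {a} {b} {c} (triangle a→b b→c c→a ab bc ca) j≢a j≢b j≢c =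
        sides (side j≢a) (side j≢b) (side j≢c)
        where
        side : ∀ {x} → j ≢ x → Arrow P j x ⊎ Arrow P x j
        side j≢x = joined complete j≢x (inj₁ j-mutable)
        reflect : ∀ {u v} → j ≢ u → j ≢ v → EitherMutable u v →
          Arrow P v j ⊎ Arrow P j u → Arrow (μ j P) u v → Arrow P u v
        reflect j≢u j≢v = μ-reflects-arrow complete (≢-sym j≢u) (≢-sym j≢v)
        apex : Triangle P a b c → SourceOrSink P j a b c → ⊥
        apex t source-or-sink = not-apex (a , b , c , j≢a , j≢b , j≢c ,
          subst (λ w → 3 ℕ.≤ weight w ℕ.+ mutCount fr a b c) (sym j-mutable)
                (s≤s (pairwise-mutable⇒2≤mutCount ab bc ca)) ,
          source-or-sink , triangle⇒orientedCycle t)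
        sides : Arrow P j a ⊎ Arrow P a j → Arrow P j b ⊎ Arrow P b j →
          Arrow P j c ⊎ Arrow P c j → ⊥
        sides (inj₁ j→a) (inj₂ b→j) _ = no-arrow-across (≢-sym j≢a) (≢-sym j≢b) ab j→a b→j a→b
        sides _ (inj₁ j→b) (inj₂ c→j) = no-arrow-across (≢-sym j≢b) (≢-sym j≢c) bc j→b c→j b→c
        sides (inj₂ a→j) _ (inj₁ j→c) = no-arrow-across (≢-sym j≢c) (≢-sym j≢a) ca j→c a→j c→a
        sides (inj₁ j→a) (inj₁ j→b) (inj₁ j→c) =
          apex (triangle (reflect j≢a j≢b ab (inj₂ j→a) a→b) (reflect j≢b j≢c bc (inj₂ j→b) b→c)
                         (reflect j≢c j≢a ca (inj₂ j→c) c→a) ab bc ca)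
               (inj₁ (ℤP.<⇒≤ j→a , ℤP.<⇒≤ j→b , ℤP.<⇒≤ j→c))
        sides (inj₂ a→j) (inj₂ b→j) (inj₂ c→j) =
          apex (triangle (reflect j≢a j≢b ab (inj₁ b→j) a→b) (reflect j≢b j≢c bc (inj₁ c→j) b→c)
                         (reflect j≢c j≢a ca (inj₁ a→j) c→a) ab bc ca)
               (inj₂ (ℤP.<⇒≤ (arrow⇒reverse<0 skew a→j) , ℤP.<⇒≤ (arrow⇒reverse<0 skew b→j) ,
                      ℤP.<⇒≤ (arrow⇒reverse<0 skew c→j)))

      μ-fork : ¬ VortexApex fr P j → Fork (μ j P) j
      μ-fork not-apex = record
        { no-triangle-avoiding = μ-no-triangle-avoiding not-apex
        ; closes-paths-through = μ-closes-paths-through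
        }

    module _ (complete : Complete fr P) {r : Fin n} (fork : Fork P r) where
      open Fork fork

      module _ {k : Fin n} (k-mutable : Mutable fr k) where

        -- The fork closes k → r → w and u → r → k.
        ¬sourceOrSink-beside-point : ∀ {u w} → Arrow P u r → Arrow P r w → k ≢ r →
          ¬ ((0ℤ ≤ P k r × 0ℤ ≤ P k w) ⊎ (P k u ≤ 0ℤ × P k r ≤ 0ℤ))
        ¬sourceOrSink-beside-point u→r r→w k≢r (inj₁ (0≤kr , 0≤kw)) =
          ℤP.<⇒≱ (arrow⇒reverse<0 skew (closes-paths-through (inj₁ k-mutable) k→r r→w)) 0≤kw
          where
          k→r : Arrow P k r
          k→r = ℤP.≤∧≢⇒< 0≤kr (complete k r k≢r (inj₁ k-mutable) ∘ sym)
        ¬sourceOrSink-beside-point u→r r→w k≢r (inj₂ (ku≤0 , kr≤0)) =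
          ℤP.<⇒≱ (closes-paths-through (inj₂ k-mutable) u→r r→k) ku≤0
          where
          r→k : Arrow P r k
          r→k = <0⇒reverse-arrow skew (ℤP.≤∧≢⇒< kr≤0 (complete k r k≢r (inj₁ k-mutable)))

        ¬sourceOrSink-over-triangle : ∀ {a b c} → Triangle P a b c → k ≢ a → k ≢ b → k ≢ c →
          ¬ SourceOrSink P k a b c
        ¬sourceOrSink-over-triangle {a} {b} {c} t@(triangle a→b b→c c→a _ _ _) k≢a k≢b k≢c
                                    source-or-sink with r ≟ a | r ≟ b | r ≟ c
        ... | yes refl | _ | _ = ¬sourceOrSink-beside-point c→a a→b k≢a
              (map (λ (ka , kb , _) → ka , kb) (λ (ka , _ , kc) → kc , ka) source-or-sink)
        ... | _ | yes refl | _ = ¬sourceOrSink-beside-point a→b b→c k≢b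
              (map (λ (_ , kb , kc) → kb , kc) (λ (ka , kb , _) → ka , kb) source-or-sink)
        ... | _ | _ | yes refl = ¬sourceOrSink-beside-point b→c c→a k≢c
              (map (λ (ka , _ , kc) → kc , ka) (λ (_ , kb , kc) → kb , kc) source-or-sink)
        ... | no r≢a | no r≢b | no r≢c = no-triangle-avoiding t r≢a r≢b r≢c

        fork⇒¬vortexApex : ¬ VortexApex fr P k
        fork⇒¬vortexApex (x , y , z , k≢x , k≢y , k≢z , _ , source-or-sink , cycle)
          with orientedCycle⇒triangle cycle | source-or-sink
        ... | inj₁ t | _ = ¬sourceOrSink-over-triangle t k≢x k≢y k≢z source-or-sink
        ... | inj₂ t | inj₁ (kx , ky , kz) =
          ¬sourceOrSink-over-triangle t k≢x k≢z k≢y (inj₁ (kx , kz , ky))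
        ... | inj₂ t | inj₂ (kx , ky , kz) =
          ¬sourceOrSink-over-triangle t k≢x k≢z k≢y (inj₂ (kx , kz , ky))

      module _ (r-mutable : Mutable fr r) {k : Fin n} (k-mutable : Mutable fr k) (k≢r : k ≢ r)
               (cp : CyclePreservingAt fr P k) where

        private
          f≢k : ∀ {f} → Frozen fr f → f ≢ k
          f≢k f-frozen = frozen≢mutable f-frozen k-mutable

          f≢r : ∀ {f} → Frozen fr f → f ≢ r
          f≢r f-frozen = frozen≢mutable f-frozen r-mutable

        μ-point-source : Arrow P r k → ∀ {x} → x ≢ k → x ≢ r → Arrow (μ k P) r x
        μ-point-source r→k {x} x≢k x≢r with joined complete (≢-sym x≢r) (inj₁ r-mutable)
        ... | inj₁ r→x = μ-keeps-arrow P (≢-sym k≢r) x≢k (inj₁ r→k) r→x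
        ... | inj₂ x→r with joined complete x≢k (inj₂ k-mutable)
        ...   | inj₁ x→k =
          ⊥-elim (arrow-asym skew x→k (closes-paths-through (inj₂ k-mutable) x→r r→k))
        ...   | inj₂ k→x = opposite-arrow-flips k-mutable cp (inj₁ r-mutable) r→k k→x x→r

        μ-point-sink : Arrow P k r → ∀ {x} → x ≢ k → x ≢ r → Arrow (μ k P) x r
        μ-point-sink k→r {x} x≢k x≢r with joined complete x≢r (inj₂ r-mutable)
        ... | inj₁ x→r = μ-keeps-arrow P x≢k (≢-sym k≢r) (inj₂ k→r) x→r
        ... | inj₂ r→x with joined complete x≢k (inj₂ k-mutable)
        ...   | inj₂ k→x =
          ⊥-elim (arrow-asym skew k→x (closes-paths-through (inj₁ k-mutable) k→r r→x))
        ...   | inj₁ x→k = opposite-arrow-flips k-mutable cp (inj₂ r-mutable) x→k k→r r→x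

        μ-point-coherent : Coherent (μ k P) r
        μ-point-coherent with joined complete (≢-sym k≢r) (inj₁ r-mutable)
        ... | inj₁ r→k = inj₂ λ f f-frozen →
          ℤP.<⇒≤ (μ-point-source r→k (f≢k f-frozen) (f≢r f-frozen))
        ... | inj₂ k→r = inj₁ λ f f-frozen →
          ℤP.<⇒≤ (arrow⇒reverse<0 (μ-skewSymmetric skew) (μ-point-sink k→r (f≢k f-frozen) (f≢r f-frozen)))

        μ-preserves-arrow-away : ∀ {u v} → u ≢ k → v ≢ k → u ≢ r → v ≢ r → EitherMutable u v →
          Arrow P u v → Arrow (μ k P) u v
        μ-preserves-arrow-away u≢k v≢k u≢r v≢r uv u→v
          with joined complete u≢k (inj₂ k-mutable) | joined complete (≢-sym v≢k) (inj₁ k-mutable)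
        ... | inj₁ u→k | _ = μ-keeps-arrow P u≢k v≢k (inj₁ u→k) u→v
        ... | inj₂ _ | inj₁ k→v = μ-keeps-arrow P u≢k v≢k (inj₂ k→v) u→v
        ... | inj₂ k→u | inj₂ v→k =
          ⊥-elim (no-triangle-avoiding (triangle u→v v→k k→u uv (inj₂ k-mutable) (inj₁ k-mutable))
                                       (≢-sym u≢r) (≢-sym v≢r) (≢-sym k≢r))

        μ-reflects-arrow-away : ∀ {u v} → u ≢ k → v ≢ k → u ≢ r → v ≢ r → EitherMutable u v →
          Arrow (μ k P) u v → Arrow P u v
        μ-reflects-arrow-away u≢k v≢k u≢r v≢r uv u→v
          with joined complete (arrow⇒≢ (μ-skewSymmetric skew) u→v) uv
        ... | inj₁ u→v′ = u→v′
        ... | inj₂ v→u = ⊥-elim (arrow-asym (μ-skewSymmetric skew) u→v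
                (μ-preserves-arrow-away v≢k u≢k v≢r u≢r (swap uv) v→u))

        μ-keeps-colour : ∀ {v} → v ≢ k → v ≢ r → Mutable fr v → Coherent P v → Coherent (μ k P) v
        μ-keeps-colour {v} v≢k v≢r v-mutable = map stays-red stays-green
          where
          stays-red : Red fr P v → Red fr (μ k P) v
          stays-red red f f-frozen = ℤP.≮⇒≥ λ v→f →
            ℤP.<⇒≱ (μ-reflects-arrow-away v≢k (f≢k f-frozen) v≢r (f≢r f-frozen) (inj₁ v-mutable) v→f)
                   (red f f-frozen)
          stays-green : Green fr P v → Green fr (μ k P) v
          stays-green green f f-frozen = ℤP.≮⇒≥ λ vf<0 →
            ℤP.<⇒≱ (arrow⇒reverse<0 skew
                      (μ-reflects-arrow-away (f≢k f-frozen) v≢k (f≢r f-frozen) v≢r (inj₂ v-mutable)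
                        (<0⇒reverse-arrow (μ-skewSymmetric skew) vf<0)))
                   (green f f-frozen)

        μ-coherent : ∀ {v} → Mutable fr v → v ≡ r ⊎ Coherent P v → Coherent (μ k P) v
        μ-coherent _ (inj₁ refl) = μ-point-coherent
        μ-coherent {v} v-mutable (inj₂ coherent) = by-position (v ≟ r) (v ≟ k)
          where
          by-position : Dec (v ≡ r) → Dec (v ≡ k) → Coherent (μ k P) v
          by-position (yes v≡r) _ = subst (Coherent (μ k P)) (sym v≡r) μ-point-coherent
          by-position (no _) (yes v≡k) = μ-swaps-colour P v≡k coherent
          by-position (no v≢r) (no v≢k) = μ-keeps-colour v≢k v≢r v-mutable coherent

Eventually : (ℕ → Set) → Set
Eventually P = ∃ λ T → ∀ j → T < j → P j

eventually-∀ : ∀ {k} {P : Fin k → ℕ → Set} →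
  (∀ i → Eventually (P i)) → Eventually (λ j → ∀ i → P i j)
eventually-∀ {zero} _ = 0 , λ _ _ ()
eventually-∀ {suc k} {P} eventually with eventually Fin.zero | eventually-∀ (eventually ∘ Fin.suc)
... | T₀ , P₀ | T , P₊ = T₀ ℕ.⊔ T , λ where
  j T₀⊔T<j Fin.zero → P₀ j (ℕP.≤-<-trans (ℕP.m≤m⊔n T₀ T) T₀⊔T<j)
  j T₀⊔T<j (Fin.suc i) → P₊ j (ℕP.≤-<-trans (ℕP.m≤n⊔m T₀ T) T₀⊔T<j) i

module _ {n : ℕ} {fr : Fin n → Bool} {B : Mat n}
         (skew : SkewSymmetric B) (complete : Complete fr B)
         {m : ℕ → Fin n} (all-mutable : AllMutable fr m) (cp : CyclePreserving fr B m) where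

  mutSeq-skewSymmetric : ∀ ℓ → SkewSymmetric (mutSeq B m ℓ)
  mutSeq-skewSymmetric zero = skew
  mutSeq-skewSymmetric (suc ℓ) = μ-skewSymmetric (mutSeq-skewSymmetric ℓ)

  mutSeq-complete : ∀ ℓ → Complete fr (mutSeq B m ℓ)
  mutSeq-complete zero = complete
  mutSeq-complete (suc ℓ) =
    μ-complete fr (mutSeq-skewSymmetric ℓ) (mutSeq-complete ℓ) (all-mutable ℓ) (cp ℓ)

  module _ (not-apex : ¬ VortexApex fr B (m 0)) where

    mutSeq-fork : ∀ ℓ → Fork fr (mutSeq B m (suc ℓ)) (m ℓ)
    mutSeq-fork zero = μ-fork fr skew complete (all-mutable 0) (cp 0) not-apex
    mutSeq-fork (suc ℓ) = μ-fork fr skew′ complete′ (all-mutable (suc ℓ)) (cp (suc ℓ))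
      (fork⇒¬vortexApex fr skew′ complete′ (mutSeq-fork ℓ) (all-mutable (suc ℓ)))
      where
      skew′ : SkewSymmetric (mutSeq B m (suc ℓ))
      skew′ = mutSeq-skewSymmetric (suc ℓ)
      complete′ : Complete fr (mutSeq B m (suc ℓ))
      complete′ = mutSeq-complete (suc ℓ)

    module _ (reduced : Reduced m) where

      mutSeq-coherent-step : ∀ ℓ {v} → Mutable fr v → v ≡ m ℓ ⊎ Coherent fr (mutSeq B m (suc ℓ)) v →
        Coherent fr (mutSeq B m (suc (suc ℓ))) v
      mutSeq-coherent-step ℓ =
        μ-coherent fr (mutSeq-skewSymmetric (suc ℓ)) (mutSeq-complete (suc ℓ)) (mutSeq-fork ℓ)
          (all-mutable ℓ) (all-mutable (suc ℓ)) (≢-sym (reduced ℓ)) (cp (suc ℓ))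

      mutSeq-coherent-after : ∀ {ℓ v} → Mutable fr v → m ℓ ≡ v →
        ∀ {j} → suc (suc ℓ) ≤′ j → Coherent fr (mutSeq B m j) v
      mutSeq-coherent-after v-mutable mutated ≤′-refl =
        mutSeq-coherent-step _ v-mutable (inj₁ (sym mutated))
      mutSeq-coherent-after v-mutable mutated (≤′-step {suc j} later) =
        mutSeq-coherent-step j v-mutable (inj₂ (mutSeq-coherent-after v-mutable mutated later))
      mutSeq-coherent-after _ _ (≤′-step {zero} (≤′-reflexive ()))

      mutSeq-eventually-coherent : WeaklyBalanced fr m →
        ∀ v → Eventually (λ j → Mutable fr v → Coherent fr (mutSeq B m j) v)
      mutSeq-eventually-coherent balanced v with fr v in fr-v
      ... | true = 0 , λ _ _ ()
      ... | false with balanced v fr-v 0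
      ...   | ℓ , _ , mutated = suc ℓ , λ _ ℓ+1<j _ → mutSeq-coherent-after fr-v mutated (ℕP.≤⇒≤′ ℓ+1<j)

theorem5p11 : (n : ℕ) (fr : Fin n → Bool) (B : Mat n) →
    SkewSymmetric B →
    Complete fr B →
    (∃ λ f → Frozen fr f) →
    (m : ℕ → Fin n) →
    AllMutable fr m →
    Reduced m →
    WeaklyBalanced fr m →
    CyclePreserving fr B m →
    ¬ VortexApex fr B (m 0) →
    ∃ λ T → ∀ j → T < j → SignCoherent fr (mutSeq B m j)
theorem5p11 n fr B skew complete _ m all-mutable reduced balanced cp not-apex =
  eventually-∀ (mutSeq-eventually-coherent skew complete all-mutable cp not-apex reduced balanced)
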